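{- There exists a covering system of the integers such that all moduli are odd, square-free, greater than $1$, and pairwise distinct, except that $7$ is used exactly six times as a modulus.
   Context: A covering system of the integers is a finite collection of congruences $x\equiv r_j \pmod{m_j}$ such that every integer satisfies at least one of them. "$7$ is used exactly six times as a modulus" means exactly six congruences of the system have modulus $7$, while all other moduli are distinct from each other and from $7$. -}

module Defs where

open import Data.Nat using (ℕ; _*_; _<_; _≟_)
open import Data.Nat.Divisibility using (_∣_)
open import Data.Integer as ℤ using (ℤ; +_)
import Data.Integer.Divisibility as ℤd
open import Data.Product using (_×_; _,_; proj₁; proj₂; Σ)
open import Data.List using (List; map; filter; length)
open import Data.List.Relation.Unary.All using (All)
open import Data.List.Relation.Unary.Any using (Any)
open import Data.List.Relation.Unary.Unique.Propositional using (Unique)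
open import Relation.Binary.PropositionalEquality using (_≡_)
open import Relation.Nullary using (¬_)
open import Relation.Nullary.Decidable using (¬?)

-- A congruence  x ≡ r (mod m)  is represented as the pair (m , r).
Congruence : Set
Congruence = ℕ × ℤ

modulus : Congruence → ℕ
modulus = proj₁

Satisfies : ℤ → Congruence → Set
Satisfies x (m , r) = (+ m) ℤd.∣ (x ℤ.- r)

IsCovering : List Congruence → Set
IsCovering S = (x : ℤ) → Any (Satisfies x) S

Odd : ℕ → Set
Odd m = ¬ (2 ∣ m)

SquareFree : ℕ → Set
SquareFree m = (d : ℕ) → d * d ∣ m → d ≡ 1

moduli : List Congruence → List ℕ
moduli S = map modulus S

moduliNot7 : List Congruence → List ℕ
moduliNot7 S = filter (λ m → ¬? (m ≟ 7)) (moduli S)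

count7 : List Congruence → ℕ
count7 S = length (filter (λ m → m ≟ 7) (moduli S))

GoodSystem : List Congruence → Set
GoodSystem S =
  IsCovering S
  × All (λ m → Odd m × SquareFree m × 1 < m) (moduli S)
  × count7 S ≡ 6
  × Unique (moduliNot7 S)

-- All moduli divide L = 3·5·7·11·13·17 = 255255, so whether an integer is covered
-- depends only on its residue modulo L.  Covering ℤ therefore reduces to covering
-- the residues 0, …, L − 1, a finite check settled by evaluation, as are the
-- conditions on the moduli.
module Submission where

open import Defs
open import Data.Bool using (Bool; T; false)
open import Data.Bool.ListAction using (all; any)
open import Data.Nat using (ℕ; zero; suc; NonZero; _*_; _≡ᵇ_; _<_; _≟_; _<?_; allUpTo?)
open import Data.Nat.Properties using (≤-<-trans; ≰⇒>; <⇒≱; *-mono-≤; ≡ᵇ⇒≡)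
open import Data.Nat.Divisibility using (_∣_; _∣?_; _∣0; ∣⇒≤; ∣-refl)
open import Data.Integer as ℤ using (ℤ; +_; -[1+_]; ∣_∣; _%ℕ_; _/ℕ_)
open import Data.Integer.Properties using (+-inverseʳ)
import Data.Integer.Divisibility.Signed as ℤs
open import Data.Integer.DivMod using (a≡a%ℕn+[a/ℕn]*n; n%ℕd<d)
open import Data.Integer.Tactic.RingSolver using (solve-∀)
open import Data.List using (List; []; _∷_; downFrom)
open import Data.List.Membership.Propositional.Properties using (∈-downFrom⁺)
open import Data.List.Relation.Unary.All as All using (All; _∷_; all?)
open import Data.List.Relation.Unary.All.Properties using (all⁺)
open import Data.List.Relation.Unary.Any as Any using (Any; here; there)
open import Data.List.Relation.Unary.Any.Properties using (any⁻)
open import Data.List.Relation.Unary.Unique.Propositional using (Unique)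
open import Data.List.Relation.Unary.Unique.DecPropositional _≟_ using (unique?)
open import Data.Product using (Σ; _×_; _,_; proj₁; proj₂)
open import Function using (_∘_; case_of_)
open import Relation.Binary.PropositionalEquality using (_≡_; refl; sym; subst)
open import Relation.Nullary using (Dec; yes; no; ¬?)
open import Relation.Nullary.Decidable using (map′; from-yes; _×-dec_; _→-dec_)
open import Relation.Unary using (Decidable)

square<square⇒< : ∀ {d b} → d * d < b * b → d < b
square<square⇒< d²<b² = ≰⇒> λ b≤d → <⇒≱ d²<b² (*-mono-≤ b≤d b≤d)

squareFree-below? : ∀ b n → n < b * b → Dec (SquareFree n)
squareFree-below? b zero _ = no λ squareFree → case squareFree 0 ∣-refl of λ ()
squareFree-below? b n@(suc _) n<b² =
  map′ (λ bounded d d²∣n → bounded (square<square⇒< (≤-<-trans (∣⇒≤ d²∣n) n<b²)) d²∣n)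
       (λ squareFree {d} _ → squareFree d)
       (allUpTo? (λ d → d * d ∣? n →-dec d ≟ 1) b)

AdmissibleModulus : ℕ → Set
AdmissibleModulus m = Odd m × SquareFree m × 1 < m

admissible-below? : ∀ b → Decidable (λ m → m < b * b × AdmissibleModulus m)
admissible-below? b m with m <? b * b
... | yes m<b² = map′ (m<b² ,_) proj₂ (¬? (2 ∣? m) ×-dec squareFree-below? b m m<b² ×-dec 1 <? m)
... | no m≮b² = no (m≮b² ∘ proj₁)

satisfies-self : ∀ x m → Satisfies x (m , x)
satisfies-self x m = subst (λ y → m ∣ ∣ y ∣) (sym (+-inverseʳ x)) (m ∣0)

satisfies-+-multiple : ∀ {m L} x k {r} → m ∣ L →
                       Satisfies x (m , r) → Satisfies (x ℤ.+ k ℤ.* + L) (m , r)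
satisfies-+-multiple {m} {L} x k {r} m∣L m∣x-r =
  ℤs.∣⇒∣ᵤ (subst (ℤs._∣_ (+ m)) (shift x k (+ L) r)
            (ℤs.∣m∣n⇒∣m+n (ℤs.∣ᵤ⇒∣ {i = x ℤ.- r} m∣x-r) (ℤs.∣n⇒∣m*n k (ℤs.∣ᵤ⇒∣ {+ m} {+ L} m∣L))))
  where
  shift : ∀ x k L r → (x ℤ.- r) ℤ.+ k ℤ.* L ≡ (x ℤ.+ k ℤ.* L) ℤ.- r
  shift = solve-∀

satisfies-%ℕ : ∀ x m .{{_ : NonZero m}} → Satisfies x (m , + (x %ℕ m))
satisfies-%ℕ x m =
  subst (λ y → Satisfies y (m , + (x %ℕ m))) (sym (a≡a%ℕn+[a/ℕn]*n x m))
        (satisfies-+-multiple (+ (x %ℕ m)) (x /ℕ m) ∣-refl (satisfies-self (+ (x %ℕ m)) m))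

-- Sound but incomplete: only residues written in reduced form 0 ≤ r < m are recognised.
satisfiesᵇ : ℤ → Congruence → Bool
satisfiesᵇ x (zero , _) = false
satisfiesᵇ x (m@(suc _) , + r) = x %ℕ m ≡ᵇ r
satisfiesᵇ x (suc _ , -[1+ _ ]) = false

satisfiesᵇ-sound : ∀ x c → T (satisfiesᵇ x c) → Satisfies x c
satisfiesᵇ-sound x (m@(suc _) , + r) x%m≡ᵇr with ≡ᵇ⇒≡ (x %ℕ m) r x%m≡ᵇr
... | refl = satisfies-%ℕ x m

residues-covered : ∀ L S → T (all (λ r → any (satisfiesᵇ (+ r)) S) (downFrom L)) →
                   ∀ {r} → r < L → Any (Satisfies (+ r)) S
residues-covered L S check {r} r<L =
  Any.map (satisfiesᵇ-sound (+ r) _)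
          (any⁻ _ S (All.lookup (all⁺ _ (downFrom L) check) (∈-downFrom⁺ r<L)))

covering-of-period : ∀ L .{{_ : NonZero L}} S → All (λ c → modulus c ∣ L) S →
                     (∀ {r} → r < L → Any (Satisfies (+ r)) S) → IsCovering S
covering-of-period L S moduli∣L residuesCovered x =
  subst (λ y → Any (Satisfies y) S) (sym (a≡a%ℕn+[a/ℕn]*n x L))
        (shift-+-multiple moduli∣L (residuesCovered (n%ℕd<d x L)))
  where
  shift-+-multiple : ∀ {C} → All (λ c → modulus c ∣ L) C → Any (Satisfies (+ (x %ℕ L))) C →
                     Any (Satisfies (+ (x %ℕ L) ℤ.+ (x /ℕ L) ℤ.* + L)) C
  shift-+-multiple (m∣L ∷ _) (here sat) = here (satisfies-+-multiple (+ (x %ℕ L)) (x /ℕ L) m∣L sat)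
  shift-+-multiple (_ ∷ m∣Ls) (there sat) = there (shift-+-multiple m∣Ls sat)

system : List Congruence
system =
  (7 , + 1) ∷ (7 , + 2) ∷ (7 , + 3) ∷ (7 , + 4) ∷ (7 , + 5) ∷ (7 , + 6) ∷
  (3 , + 1) ∷ (21 , + 14) ∷ (5 , + 1) ∷ (35 , + 7) ∷ (15 , + 3) ∷ (105 , + 84) ∷
  (11 , + 0) ∷ (33 , + 3) ∷ (55 , + 50) ∷ (165 , + 30) ∷ (77 , + 70) ∷ (231 , + 189) ∷ (385 , + 175) ∷ (1155 , + 735) ∷
  (13 , + 6) ∷ (39 , + 24) ∷ (65 , + 20) ∷ (195 , + 0) ∷ (91 , + 42) ∷ (273 , + 126) ∷ (455 , + 70) ∷ (1365 , + 840) ∷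
  (143 , + 49) ∷ (429 , + 309) ∷ (715 , + 485) ∷ (2145 , + 870) ∷ (1001 , + 896) ∷ (3003 , + 2289) ∷ (5005 , + 3745) ∷ (15015 , + 4515) ∷
  (17 , + 12) ∷ (51 , + 15) ∷ (85 , + 40) ∷ (255 , + 180) ∷ (119 , + 70) ∷ (357 , + 315) ∷ (595 , + 385) ∷ (1785 , + 1155) ∷
  (187 , + 183) ∷ (561 , + 447) ∷ (935 , + 205) ∷ (2805 , + 1635) ∷ (1309 , + 854) ∷ (3927 , + 2625) ∷ (6545 , + 1470) ∷ (19635 , + 14175) ∷
  (221 , + 119) ∷ (663 , + 600) ∷ (1105 , + 275) ∷ (3315 , + 2745) ∷ (1547 , + 1211) ∷ (4641 , + 3486) ∷ (7735 , + 2030) ∷ (23205 , + 7035) ∷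
  (2431 , + 51) ∷ (7293 , + 6099) ∷ (12155 , + 5100) ∷ (36465 , + 35955) ∷ (17017 , + 5215) ∷ (51051 , + 22491) ∷
  []

theorem3p4 : Σ (List Congruence) GoodSystem
theorem3p4 = system , covers , admissible , refl , distinct
  where
  L : ℕ
  L = 255255

  covers : IsCovering system
  covers = covering-of-period L system
             (from-yes (all? (λ c → modulus c ∣? L) system))
             (residues-covered L system _)

  -- 227² = 51529 exceeds the largest modulus 51051.
  admissible : All AdmissibleModulus (moduli system)
  admissible = All.map proj₂ (from-yes (all? (admissible-below? 227) (moduli system)))

  distinct : Unique (moduliNot7 system)
  distinct = from-yes (unique? (moduliNot7 system))
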